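{- Let $a,b$ be relatively prime positive integers and let $c$ be an integer. Then, as formal power series, $$\sum_{n=0}^{+\infty}\left\lfloor\frac{an+c}{b}\right\rfloor x^n=\frac{ax^b+(1-x)Q_{a,b,c}(x)}{(1-x)(1-x^b)},\qquad\text{where } Q_{a,b,c}(x)=\sum_{r=0}^{b-1}\left\lfloor\frac{ar+c}{b}\right\rfloor x^r.$$ -}

module Defs where

open import Data.Nat as ℕ using (ℕ; zero; suc)
open import Data.Bool using (if_then_else_)
open import Data.Integer as ℤ using (ℤ; +_; 0ℤ; 1ℤ)
open import Data.List using (List; []; _∷_; foldr; map; upTo; zipWith)
open import Data.List using (head)
open import Data.Maybe using (fromMaybe)
open import Data.Integer.DivMod using (_/ℕ_)

-- Formal power series over ℤ, represented by their coefficient sequences: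
-- F n is the coefficient of x^n.
FPS : Set
FPS = ℕ → ℤ

sumℤ : List ℤ → ℤ
sumℤ = foldr ℤ._+_ 0ℤ

infixl 6 _⊕_ _⊖_
infixl 7 _⊛_ _⊘_

_⊕_ : FPS → FPS → FPS
(F ⊕ G) n = F n ℤ.+ G n

_⊖_ : FPS → FPS → FPS
(F ⊖ G) n = F n ℤ.- G n

_⊛_ : FPS → FPS → FPS
(F ⊛ G) n = sumℤ (map (λ k → F k ℤ.* G (n ℕ.∸ k)) (upTo (suc n)))

const : ℤ → FPS
const z zero    = z
const z (suc _) = 0ℤ

X^ : ℕ → FPS
X^ k n = if n ℕ.≡ᵇ k then 1ℤ else 0ℤ

-- Inverse of a power series H with constant term 1 (the only case used),
-- computed by the usual recursion u_0 = 1,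
-- u_{m} = - Σ_{k=1}^{m} H_k u_{m-k}.
-- invPrefix H n = [u_n, u_{n-1}, ..., u_0]
invPrefix : FPS → ℕ → List ℤ
invPrefix H zero    = 1ℤ ∷ []
invPrefix H (suc n) =
  let prev = invPrefix H n in
  ℤ.- sumℤ (zipWith ℤ._*_ (map (λ k → H (suc k)) (upTo (suc n))) prev) ∷ prev

inv : FPS → FPS
inv H n = fromMaybe 0ℤ (head (invPrefix H n))

_⊘_ : FPS → FPS → FPS
G ⊘ H = G ⊛ inv H

fl : (a b : ℕ) → ℤ → .{{ℕ.NonZero b}} → ℕ → ℤ
fl a b c n = ((+ a) ℤ.* (+ n) ℤ.+ c) /ℕ b

S : (a b : ℕ) → ℤ → .{{ℕ.NonZero b}} → FPS
S a b c n = fl a b c n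

Q : (a b : ℕ) → ℤ → .{{ℕ.NonZero b}} → FPS
Q a b c r = if r ℕ.<ᵇ b then fl a b c r else 0ℤ

-- The floor sequence F n = ⌊(a n + c)/b⌋ is quasi-periodic: F (n + b) = F n + a.  For any
-- sequence with F (n + m) = F n + d and m > 0, the coefficients of (1 - x^m)(1 - x) F are read
-- off directly: below degree m they are those of (1 - x) Q, where Q is F truncated to degrees
-- below m; at degree m quasi-periodicity leaves d - F (m - 1), which is d plus the coefficient
-- of (1 - x) Q there; beyond degree m they cancel.  So (1 - x)(1 - x^m) F = d x^m + (1 - x) Q,
-- and dividing by (1 - x)(1 - x^m), whose constant term is 1, gives the theorem.

module Submission where

open import Defs
open import Data.Nat using (ℕ; NonZero)
open import Data.Nat.Coprimality using (Coprime)
open import Data.Integer using (ℤ; +_; _*_)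
open import Relation.Binary.PropositionalEquality using (_≡_)

open import Data.Bool using (true; false; if_then_else_)
open import Data.List using (_∷_; map; upTo; zipWith)
import Data.List.Properties as List
open import Data.Nat as ℕ using (zero; suc; _<_; _≤_; _<ᵇ_; _≡ᵇ_)
import Data.Nat.Properties as ℕ
open import Data.Integer as ℤ using (0ℤ; 1ℤ; _+_; _-_; -_)
open import Data.Integer.DivMod using (_/ℕ_; [n/ℕd]*d≤n; n<s[n/ℕd]*d)
import Data.Integer.Properties as ℤ
open import Data.Integer.Tactic.RingSolver using (solve-∀)
open import Function using (_∘_)
open import Relation.Binary.PropositionalEquality
  using (_≢_; _≗_; refl; sym; trans; cong; cong₂; subst; module ≡-Reasoning)
open import Relation.Nullary using (yes; no; contradiction)

shiftDown : FPS → FPS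
shiftDown F n = F (suc n)

shiftUp : ℕ → FPS → FPS
shiftUp zero    F n       = F n
shiftUp (suc m) F zero    = 0ℤ
shiftUp (suc m) F (suc n) = shiftUp m F n

Δ : ℕ → FPS → FPS
Δ m F = F ⊖ shiftUp m F

shiftUp-cong : ∀ m {F G} → F ≗ G → shiftUp m F ≗ shiftUp m G
shiftUp-cong zero    F≗G n       = F≗G n
shiftUp-cong (suc m) F≗G zero    = refl
shiftUp-cong (suc m) F≗G (suc n) = shiftUp-cong m F≗G n

Δ-cong : ∀ m {F G} → F ≗ G → Δ m F ≗ Δ m G
Δ-cong m F≗G n = cong₂ _-_ (F≗G n) (shiftUp-cong m F≗G n)

shiftUp-< : ∀ {m n} G → n < m → shiftUp m G n ≡ 0ℤ
shiftUp-< {suc m} {zero}  G _             = refl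
shiftUp-< {suc m} {suc n} G (ℕ.s≤s n<m) = shiftUp-< G n<m

shiftUp-+ : ∀ m G k → shiftUp m G (k ℕ.+ m) ≡ G k
shiftUp-+ zero    G k = cong G (ℕ.+-identityʳ k)
shiftUp-+ (suc m) G k = trans (cong (shiftUp (suc m) G) (ℕ.+-suc k m)) (shiftUp-+ m G k)

shiftUp-suc : ∀ m F n → shiftUp m F (suc n) ≡ F 0 * X^ m (suc n) + shiftUp m (shiftDown F) n
shiftUp-suc zero          F n       =
  sym (trans (cong (_+ F (suc n)) (ℤ.*-zeroʳ (F 0))) (ℤ.+-identityˡ _))
shiftUp-suc (suc zero)    F zero    = sym (trans (ℤ.+-identityʳ _) (ℤ.*-identityʳ (F 0)))
shiftUp-suc (suc (suc m)) F zero    = sym (trans (ℤ.+-identityʳ _) (ℤ.*-zeroʳ (F 0)))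
shiftUp-suc (suc m)       F (suc n) = shiftUp-suc m F n

X^-diag : ∀ m → X^ m m ≡ 1ℤ
X^-diag m with m ≡ᵇ m | ℕ.≡⇒≡ᵇ m m refl
... | true | _ = refl

X^-≢ : ∀ {m n} → n ≢ m → X^ m n ≡ 0ℤ
X^-≢ {m} {n} n≢m with n ≡ᵇ m | ℕ.≡ᵇ⇒≡ n m
... | true  | n≡m = contradiction (n≡m _) n≢m
... | false | _   = refl

const-1≗X^0 : const 1ℤ ≗ X^ 0
const-1≗X^0 zero    = refl
const-1≗X^0 (suc n) = refl

truncate : ℕ → FPS → FPS
truncate m F n = if n <ᵇ m then F n else 0ℤ

truncate-< : ∀ {m n} F → n < m → truncate m F n ≡ F n
truncate-< {m} {n} F n<m with n <ᵇ m | ℕ.<⇒<ᵇ n<m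
... | true | _ = refl

truncate-≥ : ∀ {m n} F → m ≤ n → truncate m F n ≡ 0ℤ
truncate-≥ {m} {n} F m≤n with n <ᵇ m | ℕ.<ᵇ⇒< n m
... | true  | n<m = contradiction m≤n (ℕ.<⇒≱ (n<m _))
... | false | _   = refl

Δ1-truncate-< : ∀ {m n} F → n < m → Δ 1 (truncate m F) n ≡ Δ 1 F n
Δ1-truncate-< {n = zero}  F n<m = cong (_- 0ℤ) (truncate-< F n<m)
Δ1-truncate-< {n = suc n} F n<m =
  cong₂ _-_ (truncate-< F n<m) (truncate-< F (ℕ.<-trans (ℕ.n<1+n n) n<m))

-- Agrees with _⊛_ (⊛≗conv) but recurses on the first factor, so the ring laws hold by induction.
conv : FPS → FPS → FPS
conv F G zero    = F 0 * G 0
conv F G (suc n) = F 0 * G (suc n) + conv (shiftDown F) G n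

map-upTo-suc : ∀ {A : Set} (f : ℕ → A) n → map f (upTo (suc n)) ≡ f 0 ∷ map (f ∘ suc) (upTo n)
map-upTo-suc f n = cong (f 0 ∷_) (trans (List.map-applyUpTo suc f n) (sym (List.map-upTo (f ∘ suc) n)))

⊛≗conv : ∀ F G → F ⊛ G ≗ conv F G
⊛≗conv F G zero    = ℤ.+-identityʳ _
⊛≗conv F G (suc n) = trans (cong sumℤ (map-upTo-suc (λ k → F k * G (suc n ℕ.∸ k)) (suc n)))
                             (cong (_+_ (F 0 * G (suc n))) (⊛≗conv (shiftDown F) G n))

conv-congˡ : ∀ {F F′} G → F ≗ F′ → conv F G ≗ conv F′ G
conv-congˡ G F≗F′ zero    = cong (_* G 0) (F≗F′ 0)
conv-congˡ G F≗F′ (suc n) =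
  cong₂ _+_ (cong (_* G (suc n)) (F≗F′ 0)) (conv-congˡ G (F≗F′ ∘ suc) n)

conv-congʳ : ∀ F {G G′} → G ≗ G′ → conv F G ≗ conv F G′
conv-congʳ F G≗G′ zero    = cong (F 0 *_) (G≗G′ 0)
conv-congʳ F G≗G′ (suc n) =
  cong₂ _+_ (cong (F 0 *_) (G≗G′ (suc n))) (conv-congʳ (shiftDown F) G≗G′ n)

conv-zeroˡ : ∀ G → conv (λ _ → 0ℤ) G ≗ (λ _ → 0ℤ)
conv-zeroˡ G zero    = ℤ.*-zeroˡ (G 0)
conv-zeroˡ G (suc n) = cong₂ _+_ (ℤ.*-zeroˡ (G (suc n))) (conv-zeroˡ G n)

conv-distribʳ-⊕ : ∀ F F′ G → conv (F ⊕ F′) G ≗ conv F G ⊕ conv F′ G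
conv-distribʳ-⊕ F F′ G zero    = ℤ.*-distribʳ-+ (G 0) (F 0) (F′ 0)
conv-distribʳ-⊕ F F′ G (suc n) = trans
  (cong₂ _+_ (ℤ.*-distribʳ-+ (G (suc n)) (F 0) (F′ 0))
             (conv-distribʳ-⊕ (shiftDown F) (shiftDown F′) G n))
  (interchange (F 0 * G (suc n)) (F′ 0 * G (suc n)) (conv (shiftDown F) G n) (conv (shiftDown F′) G n))
  where
  interchange : ∀ x y z w → (x + y) + (z + w) ≡ (x + z) + (y + w)
  interchange = solve-∀

conv-distribʳ-⊖ : ∀ F F′ G → conv (F ⊖ F′) G ≗ conv F G ⊖ conv F′ G
conv-distribʳ-⊖ F F′ G zero    = distrib (F 0) (F′ 0) (G 0)
  where
  distrib : ∀ f f′ g → (f - f′) * g ≡ f * g - f′ * g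
  distrib = solve-∀
conv-distribʳ-⊖ F F′ G (suc n) =
  trans (cong (_+_ ((F 0 - F′ 0) * G (suc n))) (conv-distribʳ-⊖ (shiftDown F) (shiftDown F′) G n))
        (distrib (F 0) (F′ 0) (G (suc n)) (conv (shiftDown F) G n) (conv (shiftDown F′) G n))
  where
  distrib : ∀ f f′ g x x′ → (f - f′) * g + (x - x′) ≡ (f * g + x) - (f′ * g + x′)
  distrib = solve-∀

conv-distribˡ-⊖ : ∀ F G G′ → conv F (G ⊖ G′) ≗ conv F G ⊖ conv F G′
conv-distribˡ-⊖ F G G′ zero    = distrib (F 0) (G 0) (G′ 0)
  where
  distrib : ∀ f g g′ → f * (g - g′) ≡ f * g - f * g′
  distrib = solve-∀
conv-distribˡ-⊖ F G G′ (suc n) =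
  trans (cong (_+_ (F 0 * (G (suc n) - G′ (suc n)))) (conv-distribˡ-⊖ (shiftDown F) G G′ n))
        (distrib (F 0) (G (suc n)) (G′ (suc n)) (conv (shiftDown F) G n) (conv (shiftDown F) G′ n))
  where
  distrib : ∀ f g g′ x x′ → f * (g - g′) + (x - x′) ≡ (f * g + x) - (f * g′ + x′)
  distrib = solve-∀

conv-scaleˡ : ∀ z F G → conv (λ k → z * F k) G ≗ (λ n → z * conv F G n)
conv-scaleˡ z F G zero    = ℤ.*-assoc z (F 0) (G 0)
conv-scaleˡ z F G (suc n) =
  trans (cong (_+_ (z * F 0 * G (suc n))) (conv-scaleˡ z (shiftDown F) G n))
        (distrib z (F 0) (G (suc n)) (conv (shiftDown F) G n))
  where
  distrib : ∀ z f g x → z * f * g + z * x ≡ z * (f * g + x)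
  distrib = solve-∀

-- shiftDown (conv F G) is, definitionally, (λ k → F 0 * shiftDown G k) ⊕ conv (shiftDown F) G.
conv-assoc : ∀ F G H → conv (conv F G) H ≗ conv F (conv G H)
conv-assoc F G H zero    = ℤ.*-assoc (F 0) (G 0) (H 0)
conv-assoc F G H (suc n) = trans
  (cong (_+_ (F 0 * G 0 * H (suc n))) (begin
    conv (shiftDown (conv F G)) H n
      ≡⟨ conv-distribʳ-⊕ (λ k → F 0 * shiftDown G k) (conv (shiftDown F) G) H n ⟩
    conv (λ k → F 0 * shiftDown G k) H n + conv (conv (shiftDown F) G) H n
      ≡⟨ cong₂ _+_ (conv-scaleˡ (F 0) (shiftDown G) H n) (conv-assoc (shiftDown F) G H n) ⟩
    F 0 * conv (shiftDown G) H n + conv (shiftDown F) (conv G H) n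
      ∎))
  (regroup (F 0) (G 0) (H (suc n)) (conv (shiftDown G) H n) (conv (shiftDown F) (conv G H) n))
  where
  open ≡-Reasoning
  regroup : ∀ f g h x y → f * g * h + (f * x + y) ≡ f * (g * h + x) + y
  regroup = solve-∀

conv-X^ʳ : ∀ F m → conv F (X^ m) ≗ shiftUp m F
conv-X^ʳ F zero    zero    = ℤ.*-identityʳ (F 0)
conv-X^ʳ F (suc m) zero    = ℤ.*-zeroʳ (F 0)
conv-X^ʳ F m       (suc n) =
  trans (cong (_+_ (F 0 * X^ m (suc n))) (conv-X^ʳ (shiftDown F) m n)) (sym (shiftUp-suc m F n))

-- shiftDown (X^ (suc m)) is, definitionally, X^ m.
conv-X^ˡ : ∀ m G → conv (X^ m) G ≗ shiftUp m G
conv-X^ˡ zero    G zero    = ℤ.*-identityˡ (G 0)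
conv-X^ˡ zero    G (suc n) =
  trans (cong₂ _+_ (ℤ.*-identityˡ (G (suc n))) (conv-zeroˡ G n)) (ℤ.+-identityʳ _)
conv-X^ˡ (suc m) G zero    = ℤ.*-zeroˡ (G 0)
conv-X^ˡ (suc m) G (suc n) =
  trans (cong₂ _+_ (ℤ.*-zeroˡ (G (suc n))) (conv-X^ˡ m G n)) (ℤ.+-identityˡ _)

conv-identityʳ : ∀ F → conv F (const 1ℤ) ≗ F
conv-identityʳ F n = trans (conv-congʳ F const-1≗X^0 n) (conv-X^ʳ F 0 n)

conv-one-minus-X^ʳ : ∀ F m → conv F (const 1ℤ ⊖ X^ m) ≗ Δ m F
conv-one-minus-X^ʳ F m n =
  trans (conv-distribˡ-⊖ F (const 1ℤ) (X^ m) n) (cong₂ _-_ (conv-identityʳ F n) (conv-X^ʳ F m n))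

conv-one-minus-X^ˡ : ∀ m G → conv (const 1ℤ ⊖ X^ m) G ≗ Δ m G
conv-one-minus-X^ˡ m G n = trans (conv-distribʳ-⊖ (const 1ℤ) (X^ m) G n)
  (cong₂ _-_ (trans (conv-congˡ G const-1≗X^0 n) (conv-X^ˡ 0 G n)) (conv-X^ˡ m G n))

-- invPrefix H n lists u_n, …, u_0, so pairing it with g 0, …, g n is the convolution at n.
zipWith-invPrefix≡conv : ∀ H g n →
  sumℤ (zipWith _*_ (map g (upTo (suc n))) (invPrefix H n)) ≡ conv g (inv H) n
zipWith-invPrefix≡conv H g zero    = ℤ.+-identityʳ _
zipWith-invPrefix≡conv H g (suc n) =
  trans (cong (λ l → sumℤ (zipWith _*_ l (invPrefix H (suc n)))) (map-upTo-suc g (suc n)))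
        (cong (_+_ (g 0 * inv H (suc n))) (zipWith-invPrefix≡conv H (g ∘ suc) n))

conv-inverseʳ : ∀ H → H 0 ≡ 1ℤ → conv H (inv H) ≗ const 1ℤ
conv-inverseʳ H H₀≡1 zero    = cong (_* 1ℤ) H₀≡1
conv-inverseʳ H H₀≡1 (suc n) =
  trans (cong (_+ conv (shiftDown H) (inv H) n)
              (cong₂ _*_ H₀≡1 (cong -_ (zipWith-invPrefix≡conv H (shiftDown H) n))))
        (cancel (conv (shiftDown H) (inv H) n))
  where
  cancel : ∀ x → 1ℤ * (- x) + x ≡ 0ℤ
  cancel = solve-∀

⊘-cancel : ∀ {N F H} → H 0 ≡ 1ℤ → N ≗ F ⊛ H → N ⊘ H ≗ F
⊘-cancel {N} {F} {H} H₀≡1 N≗F⊛H n = begin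
  (N ⊘ H) n                      ≡⟨ ⊛≗conv N (inv H) n ⟩
  conv N (inv H) n               ≡⟨ conv-congˡ (inv H) (λ k → trans (N≗F⊛H k) (⊛≗conv F H k)) n ⟩
  conv (conv F H) (inv H) n      ≡⟨ conv-assoc F H (inv H) n ⟩
  conv F (conv H (inv H)) n      ≡⟨ conv-congʳ F (conv-inverseʳ H H₀≡1) n ⟩
  conv F (const 1ℤ) n            ≡⟨ conv-identityʳ F n ⟩
  F n                            ∎
  where open ≡-Reasoning

QuasiPeriodic : ℕ → ℤ → FPS → Set
QuasiPeriodic m d F = ∀ k → F (k ℕ.+ m) ≡ F k + d

data Position (m : ℕ) : ℕ → Set where
  below  : ∀ {n} → n < m → Position m n
  beyond : ∀ k → Position m (k ℕ.+ m)

position : ∀ m n → Position m n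
position m n with n ℕ.<? m
... | yes n<m = below n<m
... | no  n≮m = subst (Position m) (ℕ.m∸n+n≡m (ℕ.≮⇒≥ n≮m)) (beyond (n ℕ.∸ m))

Δ-Δ-quasiPeriodic : ∀ m .{{_ : NonZero m}} d F → QuasiPeriodic m d F →
                    (λ k → d * X^ m k) ⊕ Δ 1 (truncate m F) ≗ Δ m (Δ 1 F)
Δ-Δ-quasiPeriodic m d F periodic n with position m n
... | below n<m = begin
  d * X^ m n + Δ 1 (truncate m F) n
    ≡⟨ cong₂ (λ x y → d * x + y) (X^-≢ (ℕ.<⇒≢ n<m)) (Δ1-truncate-< F n<m) ⟩
  d * 0ℤ + Δ 1 F n
    ≡⟨ drop-zeros d (Δ 1 F n) ⟩
  Δ 1 F n - 0ℤ
    ≡⟨ cong (_-_ (Δ 1 F n)) (shiftUp-< (Δ 1 F) n<m) ⟨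
  Δ m (Δ 1 F) n
    ∎
  where
  open ≡-Reasoning
  drop-zeros : ∀ d x → d * 0ℤ + x ≡ x - 0ℤ
  drop-zeros = solve-∀
Δ-Δ-quasiPeriodic (suc m) d F periodic .(suc m) | beyond zero = begin
  d * X^ (suc m) (suc m) + (truncate (suc m) F (suc m) - truncate (suc m) F m)
    ≡⟨ cong₂ (λ x y → d * x + (y - truncate (suc m) F m))
             (X^-diag (suc m)) (truncate-≥ {suc m} F ℕ.≤-refl) ⟩
  d * 1ℤ + (0ℤ - truncate (suc m) F m)
    ≡⟨ cong (λ y → d * 1ℤ + (0ℤ - y)) (truncate-< F (ℕ.n<1+n m)) ⟩
  d * 1ℤ + (0ℤ - F m)
    ≡⟨ regroup d (F 0) (F m) ⟩
  ((F 0 + d) - F m) - (F 0 - 0ℤ)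
    ≡⟨ cong₂ (λ x y → (x - F m) - y) (periodic 0) (shiftUp-+ (suc m) (Δ 1 F) 0) ⟨
  Δ (suc m) (Δ 1 F) (suc m)
    ∎
  where
  open ≡-Reasoning
  regroup : ∀ d f₀ f → d * 1ℤ + (0ℤ - f) ≡ ((f₀ + d) - f) - (f₀ - 0ℤ)
  regroup = solve-∀
Δ-Δ-quasiPeriodic m d F periodic .(suc k ℕ.+ m) | beyond (suc k) = begin
  d * X^ m (suc k ℕ.+ m) + (truncate m F (suc k ℕ.+ m) - truncate m F (k ℕ.+ m))
    ≡⟨ cong₂ (λ x y → d * x + y) (X^-≢ (ℕ.m≢1+n+m m {k} ∘ sym))
             (cong₂ _-_ (truncate-≥ F (ℕ.m≤n+m m (suc k))) (truncate-≥ F (ℕ.m≤n+m m k))) ⟩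
  d * 0ℤ + (0ℤ - 0ℤ)
    ≡⟨ cancel d (F (suc k)) (F k) ⟩
  ((F (suc k) + d) - (F k + d)) - (F (suc k) - F k)
    ≡⟨ cong₂ _-_ (cong₂ _-_ (periodic (suc k)) (periodic k)) (shiftUp-+ m (Δ 1 F) (suc k)) ⟨
  Δ m (Δ 1 F) (suc k ℕ.+ m)
    ∎
  where
  open ≡-Reasoning
  cancel : ∀ d x y → d * 0ℤ + (0ℤ - 0ℤ) ≡ ((x + d) - (y + d)) - (x - y)
  cancel = solve-∀

quasiPeriodic-⊛ : ∀ m .{{_ : NonZero m}} d F → QuasiPeriodic m d F →
                  (λ k → d * X^ m k) ⊕ ((const 1ℤ ⊖ X^ 1) ⊛ truncate m F)
                    ≗ F ⊛ ((const 1ℤ ⊖ X^ 1) ⊛ (const 1ℤ ⊖ X^ m))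
quasiPeriodic-⊛ m d F periodic n = begin
  d * X^ m n + ((const 1ℤ ⊖ X^ 1) ⊛ truncate m F) n
    ≡⟨ cong (_+_ (d * X^ m n)) (trans (⊛≗conv (const 1ℤ ⊖ X^ 1) (truncate m F) n)
                                      (conv-one-minus-X^ˡ 1 (truncate m F) n)) ⟩
  d * X^ m n + Δ 1 (truncate m F) n
    ≡⟨ Δ-Δ-quasiPeriodic m d F periodic n ⟩
  Δ m (Δ 1 F) n
    ≡⟨ Δ-cong m (conv-one-minus-X^ʳ F 1) n ⟨
  Δ m (conv F (const 1ℤ ⊖ X^ 1)) n
    ≡⟨ conv-one-minus-X^ʳ (conv F (const 1ℤ ⊖ X^ 1)) m n ⟨
  conv (conv F (const 1ℤ ⊖ X^ 1)) (const 1ℤ ⊖ X^ m) n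
    ≡⟨ conv-assoc F (const 1ℤ ⊖ X^ 1) (const 1ℤ ⊖ X^ m) n ⟩
  conv F (conv (const 1ℤ ⊖ X^ 1) (const 1ℤ ⊖ X^ m)) n
    ≡⟨ conv-congʳ F (⊛≗conv (const 1ℤ ⊖ X^ 1) (const 1ℤ ⊖ X^ m)) n ⟨
  conv F ((const 1ℤ ⊖ X^ 1) ⊛ (const 1ℤ ⊖ X^ m)) n
    ≡⟨ ⊛≗conv F ((const 1ℤ ⊖ X^ 1) ⊛ (const 1ℤ ⊖ X^ m)) n ⟨
  (F ⊛ ((const 1ℤ ⊖ X^ 1) ⊛ (const 1ℤ ⊖ X^ m))) n
    ∎
  where open ≡-Reasoning

<-suc⇒≤ : ∀ {i j} → i ℤ.< ℤ.suc j → i ℤ.≤ j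
<-suc⇒≤ {i} {j} i<1+j = ℤ.≤-trans (ℤ.i<j⇒i≤pred[j] i<1+j) (ℤ.≤-reflexive (ℤ.pred-suc j))

/ℕ-unique : ∀ z d .{{_ : NonZero d}} q → q * + d ℤ.≤ z → z ℤ.< ℤ.suc q * + d → z /ℕ d ≡ q
/ℕ-unique z d q qd≤z z<[1+q]d = ℤ.≤-antisym
  (<-suc⇒≤ (ℤ.*-cancelʳ-<-nonNeg (+ d) (ℤ.≤-<-trans ([n/ℕd]*d≤n z d) z<[1+q]d)))
  (<-suc⇒≤ (ℤ.*-cancelʳ-<-nonNeg (+ d) (ℤ.≤-<-trans qd≤z (n<s[n/ℕd]*d z d))))

/ℕ-+-* : ∀ z d .{{_ : NonZero d}} q → (z + q * + d) /ℕ d ≡ z /ℕ d + q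
/ℕ-+-* z d q = /ℕ-unique (z + q * + d) d (z /ℕ d + q) lower upper
  where
  open ℤ.≤-Reasoning
  lower : (z /ℕ d + q) * + d ℤ.≤ z + q * + d
  lower = begin
    (z /ℕ d + q) * + d       ≡⟨ ℤ.*-distribʳ-+ (+ d) (z /ℕ d) q ⟩
    z /ℕ d * + d + q * + d   ≤⟨ ℤ.+-monoˡ-≤ (q * + d) ([n/ℕd]*d≤n z d) ⟩
    z + q * + d              ∎
  upper : z + q * + d ℤ.< ℤ.suc (z /ℕ d + q) * + d
  upper = begin-strict
    z + q * + d                        <⟨ ℤ.+-monoˡ-< (q * + d) (n<s[n/ℕd]*d z d) ⟩
    ℤ.suc (z /ℕ d) * + d + q * + d     ≡⟨ regroup (z /ℕ d) q (+ d) ⟩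
    ℤ.suc (z /ℕ d + q) * + d           ∎
    where
    regroup : ∀ x q d → (1ℤ + x) * d + q * d ≡ (1ℤ + (x + q)) * d
    regroup = solve-∀

floor-quasiPeriodic : ∀ a b c .{{_ : NonZero b}} → QuasiPeriodic b (+ a) (S a b c)
floor-quasiPeriodic a b c k = begin
  (+ a * + (k ℕ.+ b) + c) /ℕ b             ≡⟨ cong (_/ℕ b) (trans (cong (λ x → + a * x + c) (ℤ.pos-+ k b))
                                                                  (regroup (+ a) (+ k) (+ b) c)) ⟩
  ((+ a * + k + c) + + a * + b) /ℕ b       ≡⟨ /ℕ-+-* (+ a * + k + c) b (+ a) ⟩
  (+ a * + k + c) /ℕ b + + a               ∎
  where
  open ≡-Reasoning
  regroup : ∀ a k b c → a * (k + b) + c ≡ (a * k + c) + a * b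
  regroup = solve-∀

-- Q a b c is, definitionally, truncate b (S a b c); with b = suc _ the constant term of the
-- denominator computes to 1.
mainTheorem15 : (a b : ℕ) → .{{_ : NonZero a}} → .{{_ : NonZero b}} → Coprime a b → (c : ℤ) → (n : ℕ) →
                  S a b c n ≡ (((λ k → (+ a) * X^ b k) ⊕ ((const (+ 1) ⊖ X^ 1) ⊛ Q a b c)) ⊘ ((const (+ 1) ⊖ X^ 1) ⊛ (const (+ 1) ⊖ X^ b))) n
mainTheorem15 a b@(suc _) _ c n =
  sym (⊘-cancel {F = S a b c} refl (quasiPeriodic-⊛ b (+ a) (S a b c) (floor-quasiPeriodic a b c)) n)
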